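{- Let $j\in I_l$ and let $x$ be a sample obtained by $D^2$-sampling from $X$ w.r.t. $B$. Then $\mathbf{Pr}[x\in X_j^{far}]\ge\frac{\varepsilon}{8\alpha k}$. Further, for any point $p\in X_j^{far}$, $\mathbf{Pr}[x=p]\ge\frac{\gamma}{|X_j|}$, where $\gamma=\frac{\varepsilon^2}{54\alpha k}$.
   Context: $\mathcal H$ is Hamming distance on $\{0,1\}^d$. Let $X\subseteq\{0,1\}^d$ be a set of $n$ points, $k\ge1$, $\mathcal R=\{R_1,\dots,R_d\}$ with $R_i\subseteq\{0,1\}^k$; a tuple $(c_1,\dots,c_k)$ satisfies $\mathcal R$ if $(c_1[i],\dots,c_k[i])\in R_i$ for every coordinate $i$. $\Phi(C,Y)=\sum_{y\in Y}\min_{c\in C}\mathcal H(y,c)$. $OPT$ is the minimum of $\Phi(C,X)$ over tuples satisfying $\mathcal R$; $OPT^\star$ is the minimum of $\Phi(C,X)$ over sets $C$ of $k$ points. Fix $0<\varepsilon\le\frac12$ and let $B$ be a set of $k$ points with $\Phi(B,X)\le\alpha OPT^\star$. $D^2$-sampling w.r.t. $B$ draws $x\in X$ with probability $\Phi(B,\{x\})/\Phi(B,X)$. Let $(c_1,\dots,c_k)$ satisfy $\mathcal R$ with $\Phi(\{c_1,\dots,c_k\},X)=OPT$, let $X_j$ be the set of $x\in X$ whose nearest center among $c_1,\dots,c_k$ is $c_j$ (ties broken arbitrarily). $I_l=\{j:\Phi(B,X_j)>\frac{\varepsilon}{6\alpha k}\Phi(B,X)\}$. For $j\in I_l$: $R_j=\frac\varepsilon9\cdot\frac{\Phi(B,X_j)}{|X_j|}$,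 $X_j^{near}=\{x\in X_j:\min_{b\in B}\mathcal H(x,b)\le R_j\}$, $X_j^{far}=X_j\setminus X_j^{near}$.
   Formalization: The parameters ε and α take rational values. -}

module Defs where

open import Data.Bool using (Bool; true; false; _xor_; if_then_else_)
open import Data.Nat as ℕ using (ℕ; zero; suc; _⊓_)
open import Data.Fin using (Fin)
import Data.Fin.Properties as FinP
open import Data.Vec using (Vec; []; _∷_; lookup; foldr′; zipWith; map; toList)
import Data.Vec.Properties as VecP
import Data.Bool.Properties as BoolP
open import Data.List as List using (List; filter)
import Data.List as L
open import Data.Nat.ListAction using (sum)
import Data.List.Membership.DecPropositional as DecMem
import Data.List.Membership.Propositional
open import Data.Integer using (+_)
open import Data.Rational as ℚ using (ℚ; 0ℚ; _/_; _÷_; ≢-nonZero)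
import Data.Rational.Properties as ℚP
open import Data.Product using (Σ; _×_; ∃)
open import Relation.Binary.PropositionalEquality using (_≡_)
open import Relation.Nullary using (Dec; yes; no; ¬?)
open import Relation.Unary using (Pred; Decidable)
open import Relation.Binary using (DecidableEquality)
open import Level using (0ℓ)

Point : ℕ → Set
Point d = Vec Bool d

_≟P_ : ∀ {d} → DecidableEquality (Point d)
_≟P_ = VecP.≡-dec BoolP._≟_

hamming : ∀ {d} → Point d → Point d → ℕ
hamming x y = sum (toList (zipWith (λ a b → if a xor b then 1 else 0) x y))

-- distance from x to the nearest point of C (C nonempty in all uses;
-- the seed value d never changes the minimum since hamming ≤ d)
distTo : ∀ {d k} → Vec (Point d) k → Point d → ℕ
distTo {d} C x = foldr′ (λ c m → hamming x c ⊓ m) d C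

Φ : ∀ {d k} → Vec (Point d) k → List (Point d) → ℕ
Φ C Y = sum (L.map (distTo C) Y)

-- a tuple (c_1..c_k) satisfies R = (R_1..R_d), R_i ⊆ {0,1}^k given by
-- its indicator function
Satisfies : ∀ {d k} → (Fin d → Vec Bool k → Bool) → Vec (Point d) k → Set
Satisfies R C = ∀ i → R i (map (λ c → lookup c i) C) ≡ true

-- m is OPT* : the minimum of Φ(C,X) over all k-tuples (sets of ≤ k points)
IsOPTstar : ∀ {d} (k : ℕ) → List (Point d) → ℕ → Set
IsOPTstar {d} k X m =
  (Σ (Vec (Point d) k) λ C → Φ C X ≡ m) × (∀ (C : Vec (Point d) k) → m ℕ.≤ Φ C X)

IsOptConstrained : ∀ {d k} → (Fin d → Vec Bool k → Bool) → List (Point d) → Vec (Point d) k → Set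
IsOptConstrained {d} {k} R X C =
  Satisfies R C × (∀ (C′ : Vec (Point d) k) → Satisfies R C′ → Φ C X ℕ.≤ Φ C′ X)

toℚ : ℕ → ℚ
toℚ n = + n / 1

-- division of rationals; only ever applied to a nonzero denominator here
-- (the value 0 on a zero denominator is never used in the statement)
_⊘_ : ℚ → ℚ → ℚ
p ⊘ q with q ℚP.≟ 0ℚ
... | yes _ = 0ℚ
... | no q≢0 = _÷_ p q {{≢-nonZero q≢0}}

D2Pr : ∀ {d k} → Vec (Point d) k → List (Point d) →
       {E : Pred (Point d) 0ℓ} → Decidable E → ℚ
D2Pr B X E? = toℚ (Φ B (filter E? X)) ⊘ toℚ (Φ B X)

-- the cluster X_j of the optimal constrained solution, given an
-- assignment σ of points to their nearest center index
cluster : ∀ {d k} → (Point d → Fin k) → List (Point d) → Fin k → List (Point d)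
cluster σ X j = filter (λ x → σ x FinP.≟ j) X

radius : ∀ {d k} → ℚ → Vec (Point d) k → List (Point d) → ℚ
radius ε B Xj = (ε ⊘ toℚ 9) ℚ.* (toℚ (Φ B Xj) ⊘ toℚ (L.length Xj))

farPart : ∀ {d k} → ℚ → Vec (Point d) k → List (Point d) → List (Point d)
farPart ε B Xj = filter (λ x → ¬? (toℚ (distTo B x) ℚ.≤? radius ε B Xj)) Xj

_∈P?_ : ∀ {d} (x : Point d) (Y : List (Point d)) → Dec (x Data.List.Membership.Propositional.∈ Y)
_∈P?_ {d} = DecMem._∈?_ (_≟P_ {d})

module Submission where

-- Points of X_j within distance R_j of B contribute at most |X_j|·R_j =
-- (ε/9)·Φ(B,X_j) ≤ Φ(B,X_j)/18, so the far part carries at least 17/18 of the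
-- cost of X_j, which by heaviness exceeds ε/(6αk)·Φ(B,X); since 6/8 ≤ 17/18
-- this gives the first bound.  A far point p has D²-weight
-- Φ(B,{p}) > R_j = (ε/9)·Φ(B,X_j)/|X_j| > (ε/9)·(ε/(6αk))·Φ(B,X)/|X_j|,
-- which is the second bound with 9·6 = 54.

open import Defs
open import Data.Bool using (Bool)
open import Data.Nat as ℕ using (ℕ; suc; z≤n; s≤s)
import Data.Nat.Properties as ℕP
open import Algebra.Properties.CommutativeSemigroup ℕP.+-commutativeSemigroup using (x∙yz≈y∙xz)
open import Data.Nat.Coprimality using (1-coprimeTo) renaming (sym to coprime-sym)
open import Data.Nat.ListAction using (sum)
open import Data.Integer as ℤ using (+_)
import Data.Integer.Properties as ℤP
open import Data.Fin using (Fin)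
import Data.Fin.Properties as FinP
open import Data.Vec using (Vec; lookup)
open import Data.List using (List; []; _∷_; length; filter; map)
open import Data.List.Properties using (filter-all; length-filter)
open import Data.List.Membership.Propositional using (_∈_)
open import Data.List.Membership.Propositional.Properties using (∈-filter⁺; ∈-filter⁻)
open import Data.List.Relation.Unary.All using (All; []; _∷_; tabulate)
open import Data.List.Relation.Unary.All.Properties using (all-filter)
open import Data.List.Relation.Unary.Unique.Propositional using (Unique)
open import Data.List.Relation.Binary.Sublist.Propositional
  using (_⊆_; []; _∷_; _∷ʳ_; ⊆-trans; from∈) renaming (lookup to ⊆-lookup)
open import Data.List.Relation.Binary.Sublist.Propositional.Properties using (filter-⊆; filter⁺)
open import Data.Product using (_×_; _,_; proj₁; proj₂)
open import Data.Rational as ℚ using (ℚ; mkℚ; 0ℚ; 1ℚ; ½; _*_; _+_; -_; _<_; _≤_; *≤*)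
import Data.Rational.Properties as ℚP
open import Data.Rational.Solver using (module +-*-Solver)
open import Data.Empty using (⊥-elim)
open import Level using (0ℓ)
open import Relation.Binary.PropositionalEquality
open import Relation.Nullary using (yes; no; ¬_; ¬?)
open import Relation.Nullary.Decidable using (from-yes)
open import Relation.Unary using (Pred; Decidable)

open +-*-Solver using (solve; _:=_; _:+_; _:*_; :-_; con)

toℚ≡mkℚ : ∀ n → toℚ n ≡ mkℚ (+ n) 0 (coprime-sym (1-coprimeTo n))
toℚ≡mkℚ n = ℚP.normalize-coprime (coprime-sym (1-coprimeTo n))

toℚ-+ : ∀ m n → toℚ (m ℕ.+ n) ≡ toℚ m + toℚ n
toℚ-+ m n = begin
  (+ m ℤ.+ + n) ℚ./ 1
    ≡⟨ cong (ℚ._/ 1) (cong₂ ℤ._+_ (ℤP.*-identityʳ (+ m)) (ℤP.*-identityʳ (+ n))) ⟨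
  (+ m ℤ.* + 1 ℤ.+ + n ℤ.* + 1) ℚ./ 1
    -- the sum of the normal forms m/1 and n/1 computes to the line above
    ≡⟨ cong₂ _+_ (toℚ≡mkℚ m) (toℚ≡mkℚ n) ⟨
  toℚ m + toℚ n
    ∎
  where open ≡-Reasoning

toℚ-mono-≤ : ∀ {m n} → m ℕ.≤ n → toℚ m ≤ toℚ n
toℚ-mono-≤ {m} {n} m≤n = subst₂ _≤_ (sym (toℚ≡mkℚ m)) (sym (toℚ≡mkℚ n))
  (*≤* (subst₂ ℤ._≤_ (sym (ℤP.*-identityʳ (+ m))) (sym (ℤP.*-identityʳ (+ n)))
                     (ℤ.+≤+ m≤n)))

toℚ-nonNeg : ∀ n → 0ℚ ≤ toℚ n
toℚ-nonNeg n = toℚ-mono-≤ {0} {n} z≤n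

toℚ-pos : ∀ {n} → 1 ℕ.≤ n → 0ℚ < toℚ n
toℚ-pos 1≤n = ℚP.<-≤-trans (ℚP.positive⁻¹ 1ℚ) (toℚ-mono-≤ 1≤n)

*-positive : ∀ {p q} → 0ℚ < p → 0ℚ < q → 0ℚ < p * q
*-positive {p} {q} p>0 q>0 =
  ℚP.positive⁻¹ (p * q) {{ℚP.pos*pos⇒pos p {{ℚ.positive p>0}} q {{ℚ.positive q>0}}}}

*-nonNegative : ∀ {p q} → 0ℚ ≤ p → 0ℚ ≤ q → 0ℚ ≤ p * q
*-nonNegative {p} {q} p≥0 q≥0 =
  ℚP.nonNegative⁻¹ (p * q)
    {{ℚP.nonNeg*nonNeg⇒nonNeg p {{ℚ.nonNegative p≥0}} q {{ℚ.nonNegative q≥0}}}}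

*-monoʳ-≤-nonNeg′ : ∀ {p q} r → 0ℚ ≤ r → p ≤ q → p * r ≤ q * r
*-monoʳ-≤-nonNeg′ r r≥0 = ℚP.*-monoʳ-≤-nonNeg r {{ℚ.nonNegative r≥0}}

*-monoˡ-≤-nonNeg′ : ∀ {p q} r → 0ℚ ≤ r → p ≤ q → r * p ≤ r * q
*-monoˡ-≤-nonNeg′ r r≥0 = ℚP.*-monoˡ-≤-nonNeg r {{ℚ.nonNegative r≥0}}

⊘-*-cancelʳ : ∀ p {q} → 0ℚ < q → (p ⊘ q) * q ≡ p
⊘-*-cancelʳ p {q} q>0 with q ℚP.≟ 0ℚ
... | yes refl = ⊥-elim (ℚP.<-irrefl refl q>0)
... | no q≢0 = begin
  p * 1/q * q   ≡⟨ ℚP.*-assoc p 1/q q ⟩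
  p * (1/q * q) ≡⟨ cong (p *_) (ℚP.*-inverseˡ q) ⟩
  p * 1ℚ        ≡⟨ ℚP.*-identityʳ p ⟩
  p             ∎
  where
  open ≡-Reasoning
  instance _ = ℚ.≢-nonZero q≢0
  1/q = ℚ.1/ q

*≤⇒≤⊘ : ∀ {x p q} → 0ℚ < q → x * q ≤ p → x ≤ p ⊘ q
*≤⇒≤⊘ {x} {p} {q} q>0 xq≤p = ℚP.*-cancelʳ-≤-pos q {{ℚ.positive q>0}}
  (subst (x * q ≤_) (sym (⊘-*-cancelʳ p q>0)) xq≤p)

⊘-nonNeg : ∀ {p q} → 0ℚ ≤ p → 0ℚ < q → 0ℚ ≤ p ⊘ q
⊘-nonNeg {p} {q} p≥0 q>0 = *≤⇒≤⊘ q>0 (subst (_≤ p) (sym (ℚP.*-zeroˡ q)) p≥0)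

module _ {A : Set} (f : A → ℕ) where

  sum-map-mono-⊆ : ∀ {xs ys} → xs ⊆ ys → sum (map f xs) ℕ.≤ sum (map f ys)
  sum-map-mono-⊆ []         = z≤n
  sum-map-mono-⊆ (y ∷ʳ τ)   = ℕP.≤-trans (sum-map-mono-⊆ τ) (ℕP.m≤n+m _ (f y))
  sum-map-mono-⊆ (refl ∷ τ) = ℕP.+-monoʳ-≤ _ (sum-map-mono-⊆ τ)

  sum-map-filter-∁ : ∀ {P : Pred A 0ℓ} (P? : Decidable P) xs →
    sum (map f (filter P? xs)) ℕ.+ sum (map f (filter (λ x → ¬? (P? x)) xs)) ≡ sum (map f xs)
  sum-map-filter-∁ P? [] = refl
  sum-map-filter-∁ P? (x ∷ xs) with P? x | sum-map-filter-∁ P? xs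
  ... | yes _ | ih = trans (ℕP.+-assoc (f x) _ _) (cong (f x ℕ.+_) ih)
  ... | no  _ | ih = trans (x∙yz≈y∙xz (sum (map f (filter P? xs))) (f x) _)
                           (cong (f x ℕ.+_) ih)

  sum-map-≤-length* : ∀ {r} xs → All (λ x → toℚ (f x) ≤ r) xs →
    toℚ (sum (map f xs)) ≤ toℚ (length xs) * r
  sum-map-≤-length* {r} []       []           = ℚP.≤-reflexive (sym (ℚP.*-zeroˡ r))
  sum-map-≤-length* {r} (x ∷ xs) (fx≤r ∷ xs≤r) = begin
    toℚ (f x ℕ.+ sum (map f xs))      ≡⟨ toℚ-+ (f x) (sum (map f xs)) ⟩
    toℚ (f x) + toℚ (sum (map f xs))  ≤⟨ ℚP.+-mono-≤ fx≤r (sum-map-≤-length* xs xs≤r) ⟩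
    r + toℚ (length xs) * r           ≡⟨ solve 2 (λ r n → r :+ n :* r := (con (toℚ 1) :+ n) :* r)
                                               refl r (toℚ (length xs)) ⟩
    (toℚ 1 + toℚ (length xs)) * r     ≡⟨ cong (_* r) (toℚ-+ 1 (length xs)) ⟨
    toℚ (suc (length xs)) * r         ∎
    where open ℚP.≤-Reasoning

  sum-map-pos⇒length-pos : ∀ xs → 0ℚ < toℚ (sum (map f xs)) → 1 ℕ.≤ length xs
  sum-map-pos⇒length-pos []      0<0 = ⊥-elim (ℚP.<-irrefl refl 0<0)
  sum-map-pos⇒length-pos (_ ∷ _) _   = s≤s z≤n

module _ {d k} (B : Vec (Point d) k) where

  nearPart : ℚ → List (Point d) → List (Point d)
  nearPart ε Y = filter (λ x → toℚ (distTo B x) ℚ.≤? radius ε B Y) Y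

  Φ-mono-⊆ : ∀ {Y Z} → Y ⊆ Z → Φ B Y ℕ.≤ Φ B Z
  Φ-mono-⊆ = sum-map-mono-⊆ (distTo B)

  Φ-≤-Φ-filter-∈ : ∀ {Y X} → Y ⊆ X → Φ B Y ℕ.≤ Φ B (filter (_∈P? Y) X)
  Φ-≤-Φ-filter-∈ {Y} {X} Y⊆X = subst (λ Z → Φ B Z ℕ.≤ Φ B (filter (_∈P? Y) X))
    (filter-all (_∈P? Y) (tabulate (λ x∈Y → x∈Y)))
    (Φ-mono-⊆ (filter⁺ (_∈P? Y) (_∈P? Y) (λ { refl x∈Y → x∈Y }) Y⊆X))

  distTo-≤-Φ-filter-≟ : ∀ {p X} → p ∈ X → distTo B p ℕ.≤ Φ B (filter (_≟P p) X)
  distTo-≤-Φ-filter-≟ {p} p∈X =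
    ℕP.≤-trans (ℕP.≤-reflexive (sym (ℕP.+-identityʳ (distTo B p))))
      (Φ-mono-⊆ (from∈ (∈-filter⁺ (_≟P p) p∈X refl)))

  ≤-D2Pr : ∀ {x} X {E : Pred (Point d) 0ℓ} (E? : Decidable E) → 0ℚ < toℚ (Φ B X) →
    x * toℚ (Φ B X) ≤ toℚ (Φ B (filter E? X)) → x ≤ D2Pr B X E?
  ≤-D2Pr X E? = *≤⇒≤⊘

  Φ-nearPart+Φ-farPart : ∀ ε Y → Φ B (nearPart ε Y) ℕ.+ Φ B (farPart ε B Y) ≡ Φ B Y
  Φ-nearPart+Φ-farPart ε Y =
    sum-map-filter-∁ (distTo B) (λ x → toℚ (distTo B x) ℚ.≤? radius ε B Y) Y

  Φ-nearPart-≤ : ∀ {ε} Y → 0ℚ ≤ ε → 1 ℕ.≤ length Y →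
    toℚ (Φ B (nearPart ε Y)) ≤ (ε ⊘ toℚ 9) * toℚ (Φ B Y)
  Φ-nearPart-≤ {ε} Y ε≥0 1≤n = begin
    toℚ (Φ B (nearPart ε Y))         ≤⟨ sum-map-≤-length* (distTo B) _ (all-filter _ Y) ⟩
    toℚ (length (nearPart ε Y)) * r  ≤⟨ *-monoʳ-≤-nonNeg′ r r≥0
                                          (toℚ-mono-≤ (length-filter _ Y)) ⟩
    toℚ n * r                        ≡⟨ solve 3 (λ n e u → n :* (e :* u) := e :* (u :* n))
                                              refl (toℚ n) e u ⟩
    e * (u * toℚ n)                  ≡⟨ cong (e *_) (⊘-*-cancelʳ _ (toℚ-pos 1≤n)) ⟩
    e * toℚ (Φ B Y)                  ∎
    where
    open ℚP.≤-Reasoning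
    n = length Y
    e = ε ⊘ toℚ 9
    u = toℚ (Φ B Y) ⊘ toℚ n
    r = radius ε B Y
    r≥0 : 0ℚ ≤ r
    r≥0 = *-nonNegative (⊘-nonNeg ε≥0 (ℚP.positive⁻¹ (toℚ 9)))
                        (⊘-nonNeg (toℚ-nonNeg (Φ B Y)) (toℚ-pos 1≤n))

  Φ-nearPart*18≤Φ : ∀ {ε} Y → 0ℚ ≤ ε → ε ≤ ½ → 1 ℕ.≤ length Y →
    toℚ (Φ B (nearPart ε Y)) * toℚ 18 ≤ toℚ (Φ B Y)
  Φ-nearPart*18≤Φ {ε} Y ε≥0 ε≤½ 1≤n = begin
    toℚ (Φ B (nearPart ε Y)) * toℚ 18
      ≤⟨ *-monoʳ-≤-nonNeg′ (toℚ 18) (toℚ-nonNeg 18) (Φ-nearPart-≤ Y ε≥0 1≤n) ⟩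
    e * F * toℚ 18
      ≡⟨ solve 2 (λ e F → e :* F :* con (toℚ 18) := e :* con (toℚ 9) :* con (toℚ 2) :* F)
                 refl e F ⟩
    e * toℚ 9 * toℚ 2 * F
      ≡⟨ cong (λ x → x * toℚ 2 * F) (⊘-*-cancelʳ ε (ℚP.positive⁻¹ (toℚ 9))) ⟩
    ε * toℚ 2 * F
      ≤⟨ *-monoʳ-≤-nonNeg′ F (toℚ-nonNeg (Φ B Y))
           (*-monoʳ-≤-nonNeg′ (toℚ 2) (toℚ-nonNeg 2) ε≤½) ⟩
    ½ * toℚ 2 * F
      ≡⟨ ℚP.*-identityˡ F ⟩
    F ∎
    where
    open ℚP.≤-Reasoning
    F = toℚ (Φ B Y)
    e = ε ⊘ toℚ 9

  Φ-farPart-≥ : ∀ {ε} Y → 0ℚ ≤ ε → ε ≤ ½ → 1 ℕ.≤ length Y →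
    toℚ (Φ B Y) * toℚ 17 ≤ toℚ (Φ B (farPart ε B Y)) * toℚ 18
  Φ-farPart-≥ {ε} Y ε≥0 ε≤½ 1≤n = begin
    F * toℚ 17
      ≡⟨ solve 1 (λ F → F :* con (toℚ 17) := F :* con (toℚ 18) :+ :- F) refl F ⟩
    F * toℚ 18 + - F
      ≤⟨ ℚP.+-monoʳ-≤ (F * toℚ 18)
           (ℚP.neg-antimono-≤ (Φ-nearPart*18≤Φ Y ε≥0 ε≤½ 1≤n)) ⟩
    F * toℚ 18 + - (N * toℚ 18)
      ≡⟨ cong (λ F → F * toℚ 18 + - (N * toℚ 18)) near+far ⟨
    (N + G) * toℚ 18 + - (N * toℚ 18)
      ≡⟨ solve 2 (λ N G → (N :+ G) :* con (toℚ 18) :+ :- (N :* con (toℚ 18)) := G :* con (toℚ 18))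
                 refl N G ⟩
    G * toℚ 18 ∎
    where
    open ℚP.≤-Reasoning
    F = toℚ (Φ B Y)
    N = toℚ (Φ B (nearPart ε Y))
    G = toℚ (Φ B (farPart ε B Y))

    near+far : N + G ≡ F
    near+far = trans (sym (toℚ-+ (Φ B (nearPart ε Y)) (Φ B (farPart ε B Y))))
                     (cong toℚ (Φ-nearPart+Φ-farPart ε Y))

module HeavyCluster {d k} (B : Vec (Point d) k) {X Y : List (Point d)} (Y⊆X : Y ⊆ X)
  {ε α K : ℚ} (ε≥0 : 0ℚ ≤ ε) (α>0 : 0ℚ < α) (K>0 : 0ℚ < K)
  (heavy : (ε ⊘ (toℚ 6 * α * K)) * toℚ (Φ B X) < toℚ (Φ B Y)) where

  private
    F  = toℚ (Φ B X)
    Fᵧ = toℚ (Φ B Y)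
    n  = toℚ (length Y)
    αK = α * K

    αK>0 : 0ℚ < αK
    αK>0 = *-positive α>0 K>0

    t : ℕ → ℚ
    t c = toℚ c * α * K

    t-pos : ∀ c → 1 ℕ.≤ c → 0ℚ < t c
    t-pos c 1≤c = *-positive (*-positive (toℚ-pos 1≤c) α>0) K>0

    y = ε ⊘ t 6

    y*t6≡ε : y * t 6 ≡ ε
    y*t6≡ε = ⊘-*-cancelʳ ε (t-pos 6 (s≤s z≤n))

  Φ-heavy-pos : 0ℚ < Fᵧ
  Φ-heavy-pos = ℚP.≤-<-trans y*F≥0 heavy
    where
    y*F≥0 : 0ℚ ≤ y * F
    y*F≥0 = *-nonNegative (⊘-nonNeg ε≥0 (t-pos 6 (s≤s z≤n))) (toℚ-nonNeg (Φ B X))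

  Φ-pos : 0ℚ < F
  Φ-pos = ℚP.<-≤-trans Φ-heavy-pos (toℚ-mono-≤ (Φ-mono-⊆ B Y⊆X))

  heavy-nonempty : 1 ℕ.≤ length Y
  heavy-nonempty = sum-map-pos⇒length-pos (distTo B) Y Φ-heavy-pos

  D2Pr-farPart-≥ : ε ≤ ½ → ε ⊘ t 8 ≤ D2Pr B X (λ x → x ∈P? farPart ε B Y)
  D2Pr-farPart-≥ ε≤½ = ≤-D2Pr B X (λ x → x ∈P? farPart ε B Y) Φ-pos
    (ℚP.≤-trans x*F≤G (toℚ-mono-≤ (Φ-≤-Φ-filter-∈ B far⊆X)))
    where
    open ℚP.≤-Reasoning
    x = ε ⊘ t 8
    G = toℚ (Φ B (farPart ε B Y))

    far⊆X : farPart ε B Y ⊆ X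
    far⊆X = ⊆-trans (filter-⊆ _ Y) Y⊆X

    αK* : ∀ c → 0ℚ ≤ αK * toℚ c
    αK* c = *-nonNegative (ℚP.<⇒≤ αK>0) (toℚ-nonNeg c)

    x*t8≡y*t6 : x * t 8 ≡ y * t 6
    x*t8≡y*t6 = trans (⊘-*-cancelʳ ε (t-pos 8 (s≤s z≤n))) (sym y*t6≡ε)

    -- The constants work out because 6/8 ≤ 17/18, i.e. 108 ≤ 136.
    x*F≤G : x * F ≤ G
    x*F≤G = ℚP.*-cancelʳ-≤-pos (αK * toℚ 144)
      {{ℚ.positive (*-positive αK>0 (ℚP.positive⁻¹ (toℚ 144)))}} (begin
      x * F * (αK * toℚ 144)
        ≡⟨ solve 4 (λ x F a K → x :* F :* (a :* K :* con (toℚ 144))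
                   := x :* (con (toℚ 8) :* a :* K) :* F :* con (toℚ 18)) refl x F α K ⟩
      x * t 8 * F * toℚ 18
        ≡⟨ cong (λ v → v * F * toℚ 18) x*t8≡y*t6 ⟩
      y * t 6 * F * toℚ 18
        ≡⟨ solve 4 (λ y F a K → y :* (con (toℚ 6) :* a :* K) :* F :* con (toℚ 18)
                   := y :* F :* (a :* K :* con (toℚ 108))) refl y F α K ⟩
      y * F * (αK * toℚ 108)
        ≤⟨ *-monoʳ-≤-nonNeg′ _ (αK* 108) (ℚP.<⇒≤ heavy) ⟩
      Fᵧ * (αK * toℚ 108)
        ≤⟨ *-monoˡ-≤-nonNeg′ Fᵧ (ℚP.<⇒≤ Φ-heavy-pos)
             (*-monoˡ-≤-nonNeg′ αK (ℚP.<⇒≤ αK>0) (from-yes (toℚ 108 ℚ.≤? toℚ 136))) ⟩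
      Fᵧ * (αK * toℚ 136)
        ≡⟨ solve 2 (λ F a → F :* (a :* con (toℚ 136)) := F :* con (toℚ 17) :* (a :* con (toℚ 8)))
                   refl Fᵧ αK ⟩
      Fᵧ * toℚ 17 * (αK * toℚ 8)
        ≤⟨ *-monoʳ-≤-nonNeg′ _ (αK* 8) (Φ-farPart-≥ B Y ε≥0 ε≤½ heavy-nonempty) ⟩
      G * toℚ 18 * (αK * toℚ 8)
        ≡⟨ solve 2 (λ G a → G :* con (toℚ 18) :* (a :* con (toℚ 8)) := G :* (a :* con (toℚ 144)))
                   refl G αK ⟩
      G * (αK * toℚ 144) ∎)

  D2Pr-point-≥ : ∀ p → p ∈ farPart ε B Y →
    ((ε * ε) ⊘ t 54) ⊘ n ≤ D2Pr B X (λ x → x ≟P p)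
  D2Pr-point-≥ p p∈far = ≤-D2Pr B X (λ x → x ≟P p) Φ-pos (begin
    z * F                                ≤⟨ z*F≤r ⟩
    r                                    <⟨ ℚP.≰⇒> (proj₂ p∈Y×far) ⟩
    toℚ (distTo B p)                     ≤⟨ toℚ-mono-≤ (distTo-≤-Φ-filter-≟ B p∈X) ⟩
    toℚ (Φ B (filter (λ x → x ≟P p) X))  ∎)
    where
    open ℚP.≤-Reasoning
    w = (ε * ε) ⊘ t 54
    z = w ⊘ n
    e = ε ⊘ toℚ 9
    u = Fᵧ ⊘ n
    r = radius ε B Y

    p∈Y×far : p ∈ Y × ¬ (toℚ (distTo B p) ≤ r)
    p∈Y×far = ∈-filter⁻ (λ x → ¬? (toℚ (distTo B x) ℚ.≤? r)) p∈far

    p∈X : p ∈ X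
    p∈X = ⊆-lookup Y⊆X (proj₁ p∈Y×far)

    n>0 : 0ℚ < n
    n>0 = toℚ-pos heavy-nonempty

    M = n * t 6 * toℚ 9

    M>0 : 0ℚ < M
    M>0 = *-positive (*-positive n>0 (t-pos 6 (s≤s z≤n))) (ℚP.positive⁻¹ (toℚ 9))

    ε*t6≥0 : 0ℚ ≤ ε * t 6
    ε*t6≥0 = *-nonNegative ε≥0 (ℚP.<⇒≤ (t-pos 6 (s≤s z≤n)))

    z*F≤r : z * F ≤ r
    z*F≤r = ℚP.*-cancelʳ-≤-pos M {{ℚ.positive M>0}} (begin
      z * F * M
        ≡⟨ solve 5 (λ z F n a K → z :* F :* (n :* (con (toℚ 6) :* a :* K) :* con (toℚ 9))
                   := z :* n :* (con (toℚ 54) :* a :* K) :* F) refl z F n α K ⟩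
      z * n * t 54 * F
        ≡⟨ cong (λ v → v * t 54 * F) (⊘-*-cancelʳ w n>0) ⟩
      w * t 54 * F
        ≡⟨ cong (_* F) (⊘-*-cancelʳ (ε * ε) (t-pos 54 (s≤s z≤n))) ⟩
      ε * ε * F
        ≡⟨ cong (λ v → ε * v * F) y*t6≡ε ⟨
      ε * (y * t 6) * F
        ≡⟨ solve 4 (λ e y t F → e :* (y :* t) :* F := e :* t :* (y :* F)) refl ε y (t 6) F ⟩
      ε * t 6 * (y * F)
        ≤⟨ *-monoˡ-≤-nonNeg′ _ ε*t6≥0 (ℚP.<⇒≤ heavy) ⟩
      ε * t 6 * Fᵧ
        ≡⟨ cong₂ (λ a b → a * t 6 * b) (⊘-*-cancelʳ ε (ℚP.positive⁻¹ (toℚ 9)))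
                                       (⊘-*-cancelʳ Fᵧ n>0) ⟨
      e * toℚ 9 * t 6 * (u * n)
        ≡⟨ solve 5 (λ e u n t c → e :* c :* t :* (u :* n) := e :* u :* (n :* t :* c))
                   refl e u n (t 6) (toℚ 9) ⟩
      r * M ∎)

lemma6 : ∀ {d : ℕ} (X : List (Point d)) → Unique X →
    (k : ℕ) → 1 ℕ.≤ k →
    (R : Fin d → Vec Bool k → Bool) →
    (ε α : ℚ) → 0ℚ < ε → ε ≤ ½ → 0ℚ < α →
    (B : Vec (Point d) k) →
    (optStar : ℕ) → IsOPTstar k X optStar →
    toℚ (Φ B X) ≤ α * toℚ optStar →
    (c : Vec (Point d) k) → IsOptConstrained R X c →
    (σ : Point d → Fin k) →
    (∀ x → x ∈ X → ∀ j′ → hamming x (lookup c (σ x)) ℕ.≤ hamming x (lookup c j′)) →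
    (j : Fin k) →
    (ε ⊘ (toℚ 6 * α * toℚ k)) * toℚ (Φ B X) < toℚ (Φ B (cluster σ X j)) →
    (ε ⊘ (toℚ 8 * α * toℚ k) ≤ D2Pr B X (λ x → x ∈P? farPart ε B (cluster σ X j)))
    ×
    (∀ p → p ∈ farPart ε B (cluster σ X j) →
      ((ε * ε) ⊘ (toℚ 54 * α * toℚ k)) ⊘ toℚ (length (cluster σ X j))
        ≤ D2Pr B X (λ x → x ≟P p))
lemma6 X _ k 1≤k _ ε α ε>0 ε≤½ α>0 B _ _ _ _ _ σ _ j heavy =
  D2Pr-farPart-≥ ε≤½ , D2Pr-point-≥
  where
  open HeavyCluster B (filter-⊆ (λ x → σ x FinP.≟ j) X)
                      (ℚP.<⇒≤ ε>0) α>0 (toℚ-pos 1≤k) heavy
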